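{- Let $s\in\mathcal{Q}\setminus\{0,1,\infty\}$, with parents $s_0,s_1$ labelled so that the parents of $s_1$ are $s_0$ and $s'\in\mathcal{Q}$. Then $J_{s'}\setminus J_s$ consists of a single point $x_s$, which is an extremal point of $J_{s'}$, and $$J_{s_0}+J_{s_1}+\Lambda=J_s\sqcup\{x_s\}.$$
   Context: $\mathcal{Q}=\mathbb{Q}^{\ge0}\cup\{\infty\}$; each $s\in\mathcal{Q}$ is written uniquely $s=q/p$ with $p,q\in\mathbb{N}$ coprime ($\infty=1/0$). For such $s$ define $J_s=\{(\alpha,\beta)\in\mathbb{Z}^2:\ \alpha\equiv q,\ \beta\equiv p \pmod 2;\ \alpha\ge-q;\ \beta\ge-p;\ \alpha+\beta\le p+q-2;\ p\alpha+q\beta\ge0\}$, $P^s_i=(q+2i,-p)$, $Q^s_j=(-q,p+2j)$, and $\Lambda=\{(0,0),(0,2),(2,0)\}$; sums of sets are Minkowski sums. Extremal points of $J_s$: if $s\notin\{0,\infty\}$ these are $P^s_0,P^s_{p-1},Q^s_0,Q^s_{q-1}$ (possibly with repetitions); if $s\in\{0,\infty\}$, $J_s$ is a single point (namely $(0,-1)$ for $s=0$, $(-1,0)$ for $s=\infty$), which is its extremal point. Farey triangulation: geodesics in the hyperbolic plane $\mathbb{H}^2$ (boundary $\mathbb{P}^1\mathbb{R}$) joining $q_0/p_0$ and $q_1/p_1$ whenever $|p_0q_1-p_1q_0|=1$ (Farey edges). Parents: for $s\in\mathcal{Q}\setminus\{0,1,\infty\}$, let $L_s$ be the geodesic from $s$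 to the point $\sqrt{ -1}$ (the midpoint of the edge $0\infty$); the parents of $s$ are the endpoints $s_0,s_1$ of the first Farey edge crossed by $L_s$ (the one closest to $s$). By convention the parents of $1$ are $0$ and $\infty$. After possibly exchanging the indices, the parents of $s_1$ are $s_0$ and a third point $s'\in\mathcal{Q}$. Writing $s=q/p$, $s'=q'/p'$, $s_0=q_0/p_0$, $s_1=q_1/p_1$, one has $(p,q)=(p_1,q_1)+(p_0,q_0)$, $(p',q')=(p_1,q_1)-(p_0,q_0)$, and $p_0q_1-p_1q_0=\pm1$. -}

module Defs where

open import Data.Nat as ℕ using (ℕ; _∸_)
open import Data.Integer as ℤ using (ℤ; +_; -_; _+_; _-_; _*_; _≤_; 0ℤ; 1ℤ; -1ℤ)
open import Data.Integer.Divisibility using (_∣_)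
open import Data.Product using (_×_; _,_; ∃; ∃-syntax)
open import Data.Sum using (_⊎_)
open import Relation.Binary.PropositionalEquality using (_≡_; _≢_)

-- An element s = q/p of 𝒬 is represented by the pair (q , p) of naturals
-- (numerator first); ∞ = (1 , 0), 0 = (0 , 1).
Slope : Set
Slope = ℕ × ℕ

Pt : Set
Pt = ℤ × ℤ

_+ᵥ_ : Pt → Pt → Pt
(a , b) +ᵥ (c , d) = (a + c , b + d)

_⊕_ : (Pt → Set) → (Pt → Set) → Pt → Set
(A ⊕ B) y = ∃[ a ] ∃[ b ] (A a × B b × y ≡ a +ᵥ b)

J : Slope → Pt → Set
J (q , p) (α , β) =
  (+ 2 ∣ (α - + q)) × (+ 2 ∣ (β - + p)) ×
  (- (+ q) ≤ α) × (- (+ p) ≤ β) ×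
  (α + β ≤ (+ p + + q) - + 2) ×
  (0ℤ ≤ + p * α + + q * β)

P : Slope → ℕ → Pt
P (q , p) i = (+ q + + 2 * + i , - (+ p))

Q : Slope → ℕ → Pt
Q (q , p) j = (- (+ q) , + p + + 2 * + j)

Λ : Pt → Set
Λ y = (y ≡ (0ℤ , 0ℤ)) ⊎ (y ≡ (0ℤ , + 2)) ⊎ (y ≡ (+ 2 , 0ℤ))

ExtremalPoint : Slope → Pt → Set
ExtremalPoint (q , p) x =
  (q ≡ 0 × p ≡ 1 × x ≡ (0ℤ , -1ℤ)) ⊎
  (q ≡ 1 × p ≡ 0 × x ≡ (-1ℤ , 0ℤ)) ⊎
  (q ≢ 0 × p ≢ 0 ×
     (x ≡ P (q , p) 0 ⊎ x ≡ P (q , p) (p ∸ 1) ⊎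
      x ≡ Q (q , p) 0 ⊎ x ≡ Q (q , p) (q ∸ 1)))

-- Parents s a b : a and b are the (Farey) parents of s, i.e. the unique
-- (unordered) pair of Farey neighbours a = q₀/p₀, b = q₁/p₁ (p₀q₁ - p₁q₀ = ±1)
-- whose mediant is s: (p , q) = (p₀ + p₁ , q₀ + q₁).  This also reproduces the
-- convention that the parents of 1 are 0 and ∞; 0 and ∞ have no parents.
Parents : Slope → Slope → Slope → Set
Parents (q , p) (q₀ , p₀) (q₁ , p₁) =
  q ≡ q₀ ℕ.+ q₁ × p ≡ p₀ ℕ.+ p₁ ×
  ((+ p₀ * + q₁ - + p₁ * + q₀ ≡ 1ℤ) ⊎ (+ p₀ * + q₁ - + p₁ * + q₀ ≡ -1ℤ))

-- In the coordinates m = (α + q)/2, n = (β + p)/2 the set J_s becomes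
-- Jℕ s = {(m , n) ∈ ℕ² : m + n < q + p, qp ≤ pm + qn}, Minkowski sums become sums in ℕ², and
-- Λ becomes {0, e₁, e₂}. Let σ < τ be Farey neighbours with mediant s = σ ⊞ τ. The weight
-- w(m , n) = pm + qn of s is minimised on Jℕ σ only at its corner (q_σ , 0) and on Jℕ τ only at
-- its corner (0 , p_τ), and their sum x = (q_σ , p_τ) has w(x) = qp − 1; hence x is the only
-- point of Jℕ σ + Jℕ τ + Λℕ outside Jℕ s. Conversely (q_τ , p_σ) has weight qp + 1, so every
-- z ∈ Jℕ s satisfies m ≥ q_τ or n ≥ p_σ. In the first case z − (q_τ , 0) lies above the
-- hypotenuse of σ, within distance p_τ above a point of Jℕ σ, and the leftover step added to the
-- corner (q_τ , 0) of Jℕ τ is a point of Jℕ τ plus an element of Λℕ; the second case is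
-- symmetric. For s = s₀ ⊞ s₁ with s₁ = s₀ ⊞ s′, w is also minimised on Jℕ s′ only at its corner
-- (0 , p_s′), whose translate by s₀ is x: this gives J_s′ ∖ J_s = {x}. When the determinant of
-- the parents is −1 the two coordinates are exchanged.

module Submission where

open import Defs
open import Data.Nat using (ℕ)
open import Data.Nat.Coprimality using (Coprime)
open import Data.Product using (_×_; _,_; proj₁; proj₂; ∃-syntax; ∃₂; swap)
open import Data.Sum using (_⊎_; inj₁; inj₂; [_,_]′; map; map₁; map₂)
open import Relation.Nullary using (¬_)
open import Relation.Binary.PropositionalEquality hiding (J)
open import Function.Bundles using (_⇔_; mk⇔; Equivalence)
open import Function.Base using (_$_; _∘_)
open import Data.List using (_∷_; [])
open import Data.Empty using (⊥-elim)

ℕ² : Set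
ℕ² = ℕ × ℕ

module Halved where

  open import Data.Nat using (zero; suc; _+_; _*_; _≤_; _<_; z≤n; s≤s; NonZero; >-nonZero; z<s; pred)
  open import Data.Nat.Properties
  open import Algebra.Properties.CommutativeSemigroup +-commutativeSemigroup using (interchange)
  open import Data.Nat.Tactic.RingSolver using (solve)
  open import Relation.Nullary.Decidable using (yes; no)

  private variable
    m n q p e : ℕ
    σ τ ρ s s₀ s′ : Slope
    u v z δ l c c′ z′ : ℕ²

  infixl 6 _⊞_
  infix 4 _≺_ _⌢_

  _⊞_ : ℕ² → ℕ² → ℕ²
  (a , b) ⊞ (c , d) = (a + c , b + d)

  ‖_‖ : ℕ² → ℕ
  ‖ m , n ‖ = m + n

  area : Slope → ℕ
  area (q , p) = q * p

  weight : Slope → ℕ² → ℕ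
  weight (q , p) (m , n) = p * m + q * n

  ⊞-comm : ∀ u v → u ⊞ v ≡ v ⊞ u
  ⊞-comm (a , b) (c , d) = cong₂ _,_ (+-comm a c) (+-comm b d)

  ⊞-assoc : ∀ u v z → (u ⊞ v) ⊞ z ≡ u ⊞ (v ⊞ z)
  ⊞-assoc (a , b) (c , d) (e , f) = cong₂ _,_ (+-assoc a c e) (+-assoc b d f)

  ⊞-identityʳ : ∀ u → u ⊞ (0 , 0) ≡ u
  ⊞-identityʳ (a , b) = cong₂ _,_ (+-identityʳ a) (+-identityʳ b)

  ⊞-cancelˡ : ∀ u {v z} → u ⊞ v ≡ u ⊞ z → v ≡ z
  ⊞-cancelˡ (a , b) eq = cong₂ _,_ (+-cancelˡ-≡ a _ _ (cong proj₁ eq)) (+-cancelˡ-≡ b _ _ (cong proj₂ eq))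

  ⊞-regroup : ∀ {x} → z ≡ u ⊞ δ → x ⊞ δ ≡ v ⊞ l → x ⊞ z ≡ u ⊞ v ⊞ l
  ⊞-regroup {z} {u} {δ} {v} {l} {x} z≡ x⊞δ≡ = begin
    x ⊞ z          ≡⟨ cong (x ⊞_) z≡ ⟩
    x ⊞ (u ⊞ δ)    ≡⟨ sym (⊞-assoc x u δ) ⟩
    x ⊞ u ⊞ δ      ≡⟨ cong (_⊞ δ) (⊞-comm x u) ⟩
    u ⊞ x ⊞ δ      ≡⟨ ⊞-assoc u x δ ⟩
    u ⊞ (x ⊞ δ)    ≡⟨ cong (u ⊞_) x⊞δ≡ ⟩
    u ⊞ (v ⊞ l)    ≡⟨ sym (⊞-assoc u v l) ⟩
    u ⊞ v ⊞ l      ∎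
    where open ≡-Reasoning

  ‖‖-⊞ : ∀ u v → ‖ u ⊞ v ‖ ≡ ‖ u ‖ + ‖ v ‖
  ‖‖-⊞ (a , b) (c , d) = interchange a c b d

  weight-⊞ : ∀ s u v → weight s (u ⊞ v) ≡ weight s u + weight s v
  weight-⊞ (q , p) (a , b) (c , d) =
    trans (cong₂ _+_ (*-distribˡ-+ p a c) (*-distribˡ-+ q b d)) (interchange (p * a) (p * c) (q * b) (q * d))

  weight-swap : ∀ s z → weight (swap s) (swap z) ≡ weight s z
  weight-swap (q , p) (m , n) = +-comm (q * n) (p * m)

  record _≺_ (σ τ : Slope) : Set where
    constructor ≺-intro
    field ≺-gap : proj₂ τ * proj₁ σ < proj₂ σ * proj₁ τ

  -- σ < τ are Farey neighbours: the determinant p₀q₁ − p₁q₀ of Parents is 1.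
  record _⌢_ (σ τ : Slope) : Set where
    constructor ⌢-intro
    field det : proj₂ σ * proj₁ τ ≡ 1 + proj₂ τ * proj₁ σ

  ⌢⇒≺ : σ ⌢ τ → σ ≺ τ
  ⌢⇒≺ (⌢-intro det) = ≺-intro (≤-reflexive (sym det))

  ≺-swap : σ ≺ τ → swap τ ≺ swap σ
  ≺-swap {q , p} {q′ , p′} (≺-intro gap) = ≺-intro (subst₂ _<_ (*-comm p′ q) (*-comm p q′) gap)

  ⌢-swap : σ ⌢ τ → swap τ ⌢ swap σ
  ⌢-swap {q , p} {q′ , p′} (⌢-intro det) = ⌢-intro (trans (*-comm q′ p) (trans det (cong suc (*-comm p′ q))))

  ≺⇒0<p : σ ≺ τ → 0 < proj₂ σ
  ≺⇒0<p {_ , zero}  (≺-intro ())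
  ≺⇒0<p {_ , suc _} _ = s≤s z≤n

  ≺⇒0<q : σ ≺ τ → 0 < proj₁ τ
  ≺⇒0<q σ≺τ = ≺⇒0<p (≺-swap σ≺τ)

  ⌢-mediantˡ : σ ⌢ τ → σ ⌢ σ ⊞ τ
  ⌢-mediantˡ {q , p} {q′ , p′} (⌢-intro det) = ⌢-intro $ begin
    p * (q + q′)         ≡⟨ *-distribˡ-+ p q q′ ⟩
    p * q + p * q′       ≡⟨ cong (p * q +_) det ⟩
    p * q + (1 + p′ * q) ≡⟨ solve (q ∷ p ∷ p′ ∷ []) ⟩
    1 + (p + p′) * q     ∎
    where open ≡-Reasoning

  ⌢-mediantʳ : σ ⌢ τ → σ ⊞ τ ⌢ τ
  ⌢-mediantʳ {q , p} {q′ , p′} (⌢-intro det) = ⌢-intro $ begin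
    (p + p′) * q′          ≡⟨ *-distribʳ-+ q′ p p′ ⟩
    p * q′ + p′ * q′       ≡⟨ cong (_+ p′ * q′) det ⟩
    1 + p′ * q + p′ * q′   ≡⟨ solve (q ∷ q′ ∷ p′ ∷ []) ⟩
    1 + p′ * (q + q′)      ∎
    where open ≡-Reasoning

  ⊞-≺ : σ ≺ ρ → τ ≺ ρ → σ ⊞ τ ≺ ρ
  ⊞-≺ {q , p} {Q , P} {q′ , p′} (≺-intro σ≺ρ) (≺-intro τ≺ρ) =
    ≺-intro (subst₂ _<_ (sym (*-distribˡ-+ P q q′)) (sym (*-distribʳ-+ Q p p′)) (+-mono-< σ≺ρ τ≺ρ))

  ⌢-exception : σ ⌢ τ → 1 + weight (σ ⊞ τ) (proj₁ σ , proj₂ τ) ≡ area (σ ⊞ τ)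
  ⌢-exception {a , b} {c , d} (⌢-intro det) = begin
    1 + ((b + d) * a + (a + c) * d)         ≡⟨ solve (a ∷ b ∷ c ∷ d ∷ []) ⟩
    (1 + d * a) + (a * b + a * d + c * d)   ≡⟨ cong (_+ (a * b + a * d + c * d)) (sym det) ⟩
    b * c + (a * b + a * d + c * d)         ≡⟨ solve (a ∷ b ∷ c ∷ d ∷ []) ⟩
    (a + c) * (b + d)                       ∎
    where open ≡-Reasoning

  ⌢-cover : σ ⌢ τ → weight (σ ⊞ τ) (proj₁ τ , proj₂ σ) ≡ 1 + area (σ ⊞ τ)
  ⌢-cover {a , b} {c , d} (⌢-intro det) = begin
    (b + d) * c + (a + c) * b               ≡⟨ solve (a ∷ b ∷ c ∷ d ∷ []) ⟩
    b * c + (a * b + c * b + c * d)         ≡⟨ cong (_+ (a * b + c * b + c * d)) det ⟩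
    (1 + d * a) + (a * b + c * b + c * d)   ≡⟨ solve (a ∷ b ∷ c ∷ d ∷ []) ⟩
    1 + (a + c) * (b + d)                   ∎
    where open ≡-Reasoning

  ⌢-weight : ρ ⌢ s → ∀ z → proj₂ s * weight ρ z + proj₂ z ≡ proj₂ ρ * weight s z
  ⌢-weight {a , b} {Q , P} (⌢-intro det) (m , n) = begin
    P * (b * m + a * n) + n         ≡⟨ solve (a ∷ b ∷ P ∷ m ∷ n ∷ []) ⟩
    P * b * m + (1 + P * a) * n     ≡⟨ cong (λ t → P * b * m + t * n) (sym det) ⟩
    P * b * m + b * Q * n           ≡⟨ solve (b ∷ Q ∷ P ∷ m ∷ n ∷ []) ⟩
    b * (P * m + Q * n)             ∎
    where open ≡-Reasoning

  -- Halved coordinates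

  Upper : Slope → ℕ² → Set
  Upper s z = area s ≤ weight s z

  -- J (q , p) read in the coordinates m = (α + q)/2, n = (β + p)/2.
  record Jℕ (s : Slope) (z : ℕ²) : Set where
    constructor _,_
    field
      size  : ‖ z ‖ < ‖ s ‖
      upper : Upper s z

  Jℕ-swap : Jℕ s z → Jℕ (swap s) (swap z)
  Jℕ-swap {q , p} {m , n} (size , upper) =
    subst₂ _<_ (+-comm m n) (+-comm q p) size ,
    subst₂ _≤_ (*-comm q p) (sym (weight-swap (q , p) (m , n))) upper

  Jℕ-cornerₓ : 0 < p → Jℕ (q , p) (q , 0)
  Jℕ-cornerₓ {p} {q} 0<p =
    +-monoʳ-< q 0<p , subst (_≤ p * q + q * 0) (*-comm p q) (m≤m+n (p * q) (q * 0))

  Jℕ-cornerᵧ : 0 < q → Jℕ (q , p) (0 , p)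
  Jℕ-cornerᵧ 0<q = Jℕ-swap (Jℕ-cornerₓ 0<q)

  -- Corners minimising the weight

  infix 4 _⊑[_]_

  data _⊑[_]_ (c : ℕ²) (s : Slope) : ℕ² → Set where
    same    : c ⊑[ s ] c
    lighter : weight s c < weight s z → c ⊑[ s ] z

  ⊑⇒≤ : c ⊑[ s ] z → weight s c ≤ weight s z
  ⊑⇒≤ same        = ≤-refl
  ⊑⇒≤ (lighter lt) = <⇒≤ lt

  weight-⊞-< : ∀ s → weight s c + weight s c′ < weight s z + weight s z′ →
               weight s (c ⊞ c′) < weight s (z ⊞ z′)
  weight-⊞-< {c} {c′} {z} {z′} s = subst₂ _<_ (sym (weight-⊞ s c c′)) (sym (weight-⊞ s z z′))

  ⊑-⊞ : c ⊑[ s ] z → c′ ⊑[ s ] z′ → c ⊞ c′ ⊑[ s ] z ⊞ z′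
  ⊑-⊞ same         same          = same
  ⊑-⊞ {c} {s} same (lighter lt′) = lighter (weight-⊞-< s (+-monoʳ-< (weight s c) lt′))
  ⊑-⊞ {s = s} (lighter lt) h′    = lighter (weight-⊞-< s (+-mono-<-≤ lt (⊑⇒≤ h′)))

  ⊑⇒Upper⊎≡ : 1 + weight s c ≡ area s → c ⊑[ s ] z → Upper s z ⊎ z ≡ c
  ⊑⇒Upper⊎≡ _  same = inj₂ refl
  ⊑⇒Upper⊎≡ {s} {c} {z} eq (lighter lt) = inj₁ (subst (_≤ weight s z) eq lt)

  ⊑-swap : c ⊑[ swap s ] swap z → swap c ⊑[ s ] z
  ⊑-swap same = same
  ⊑-swap {c} {s} {z} (lighter lt) = lighter (subst₂ _<_ (weight-swap s (swap c)) (weight-swap s z) lt)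

  corner-minimalₓ : σ ≺ s → 0 < proj₂ s → Jℕ σ z → (proj₁ σ , 0) ⊑[ s ] z
  corner-minimalₓ {q , p} {Q , P} {m , zero} σ≺s 0<P (_ , upper)
    with m≤n⇒m<n∨m≡n q≤m
    where
    instance _ = >-nonZero (≺⇒0<p σ≺s)
    pm : p * m + q * 0 ≡ m * p
    pm = solve (p ∷ q ∷ m ∷ [])
    q≤m : q ≤ m
    q≤m = *-cancelʳ-≤ q m p (subst (q * p ≤_) pm upper)
  ... | inj₁ q<m  = lighter (+-monoˡ-< (Q * 0) (*-monoʳ-< P q<m))
    where instance _ = >-nonZero 0<P
  ... | inj₂ refl = same
  corner-minimalₓ {q , p} {Q , P} {m , suc k} (≺-intro σ≺s) _ (_ , upper) = lighter (gap (suc k) upper)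
    where
    open ≤-Reasoning
    gap : ∀ n .{{_ : NonZero n}} → q * p ≤ p * m + q * n → P * q + Q * 0 < P * m + Q * n
    gap n upper = *-cancelˡ-< p (P * q + Q * 0) (P * m + Q * n) (begin-strict
      p * (P * q + Q * 0)     ≡⟨ solve (q ∷ p ∷ Q ∷ P ∷ []) ⟩
      P * (q * p)             ≤⟨ *-monoʳ-≤ P upper ⟩
      P * (p * m + q * n)     ≡⟨ solve (q ∷ p ∷ P ∷ m ∷ n ∷ []) ⟩
      P * (p * m) + P * q * n <⟨ +-monoʳ-< (P * (p * m)) (*-monoˡ-< n σ≺s) ⟩
      P * (p * m) + p * Q * n ≡⟨ solve (q ∷ p ∷ Q ∷ P ∷ m ∷ n ∷ []) ⟩
      p * (P * m + Q * n)     ∎)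

  corner-minimalᵧ : s ≺ σ → 0 < proj₁ s → Jℕ σ z → (0 , proj₂ σ) ⊑[ s ] z
  corner-minimalᵧ s≺σ 0<q j = ⊑-swap (corner-minimalₓ (≺-swap s≺σ) 0<q (Jℕ-swap j))

  data Λℕ : ℕ² → Set where
    origin : Λℕ (0 , 0)
    e₁     : Λℕ (1 , 0)
    e₂     : Λℕ (0 , 1)

  Λℕ-swap : Λℕ l → Λℕ (swap l)
  Λℕ-swap origin = origin
  Λℕ-swap e₁     = e₂
  Λℕ-swap e₂     = e₁

  ‖Λℕ‖≤1 : Λℕ l → ‖ l ‖ ≤ 1
  ‖Λℕ‖≤1 origin = z≤n
  ‖Λℕ‖≤1 e₁     = ≤-refl
  ‖Λℕ‖≤1 e₂     = ≤-refl

  origin-⊑ : 0 < proj₁ s → 0 < proj₂ s → Λℕ l → (0 , 0) ⊑[ s ] l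
  origin-⊑ _ _ origin = same
  origin-⊑ {Q , P} _ 0<P e₁ = lighter (+-monoˡ-< (Q * 0) (*-monoʳ-< P z<s))
    where instance _ = >-nonZero 0<P
  origin-⊑ {Q , P} 0<Q _ e₂ = lighter (+-monoʳ-< (P * 0) (*-monoʳ-< Q z<s))
    where instance _ = >-nonZero 0<Q

  Decomposition : Slope → Slope → ℕ² → Set
  Decomposition σ τ z = ∃[ u ] ∃[ v ] ∃[ l ] (Jℕ σ u × Jℕ τ v × Λℕ l × z ≡ u ⊞ v ⊞ l)

  Decomposition-swap : Decomposition σ τ z → Decomposition (swap σ) (swap τ) (swap z)
  Decomposition-swap (u , v , l , u∈ , v∈ , l∈ , z≡) =
    swap u , swap v , swap l , Jℕ-swap u∈ , Jℕ-swap v∈ , Λℕ-swap l∈ , cong swap z≡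

  Decomposition-comm : Decomposition σ τ z → Decomposition τ σ z
  Decomposition-comm (u , v , l , u∈ , v∈ , l∈ , z≡) =
    v , u , l , v∈ , u∈ , l∈ , trans z≡ (cong (_⊞ l) (⊞-comm u v))

  corner-sum : ∀ q p → (q , 0) ⊞ (0 , p) ⊞ (0 , 0) ≡ (q , p)
  corner-sum q p = cong₂ _,_ (trans (+-identityʳ (q + 0)) (+-identityʳ q)) (+-identityʳ p)

  ‖⊕‖< : Jℕ σ u → Jℕ τ v → Λℕ l → ‖ u ⊞ v ⊞ l ‖ < ‖ σ ⊞ τ ‖
  ‖⊕‖< {σ} {u} {τ} {v} {l} (u< , _) (v< , _) l∈ = begin-strict
    ‖ u ⊞ v ⊞ l ‖           ≡⟨ trans (‖‖-⊞ (u ⊞ v) l) (cong (_+ ‖ l ‖) (‖‖-⊞ u v)) ⟩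
    ‖ u ‖ + ‖ v ‖ + ‖ l ‖   ≤⟨ +-monoʳ-≤ (‖ u ‖ + ‖ v ‖) (‖Λℕ‖≤1 l∈) ⟩
    ‖ u ‖ + ‖ v ‖ + 1       ≡⟨ trans (+-assoc ‖ u ‖ ‖ v ‖ 1) (cong (‖ u ‖ +_) (+-comm ‖ v ‖ 1)) ⟩
    ‖ u ‖ + suc ‖ v ‖       <⟨ +-mono-<-≤ u< v< ⟩
    ‖ σ ‖ + ‖ τ ‖           ≡⟨ sym (‖‖-⊞ σ τ) ⟩
    ‖ σ ⊞ τ ‖               ∎
    where open ≤-Reasoning

  exception∉ : σ ⌢ τ → ¬ Jℕ (σ ⊞ τ) (proj₁ σ , proj₂ τ)
  exception∉ σ⌢τ (_ , upper) = <⇒≱ (≤-reflexive (⌢-exception σ⌢τ)) upper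

  exception∈⊕ : σ ⌢ τ → Decomposition σ τ (proj₁ σ , proj₂ τ)
  exception∈⊕ {σ} {τ} σ⌢τ =
    (proj₁ σ , 0) , (0 , proj₂ τ) , (0 , 0) ,
    Jℕ-cornerₓ (≺⇒0<p σ≺τ) , Jℕ-cornerᵧ (≺⇒0<q σ≺τ) , origin ,
    sym (corner-sum (proj₁ σ) (proj₂ τ))
    where σ≺τ = ⌢⇒≺ σ⌢τ

  ⊕-⊆ : σ ⌢ τ → Jℕ σ u → Jℕ τ v → Λℕ l →
        Jℕ (σ ⊞ τ) (u ⊞ v ⊞ l) ⊎ u ⊞ v ⊞ l ≡ (proj₁ σ , proj₂ τ)
  ⊕-⊆ {σ} {τ} {u} {v} {l} σ⌢τ u∈ v∈ l∈ =
    map₁ (‖⊕‖< u∈ v∈ l∈ ,_) (⊑⇒Upper⊎≡ (⌢-exception σ⌢τ) minimal)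
    where
    σ≺s = ⌢⇒≺ (⌢-mediantˡ σ⌢τ)
    s≺τ = ⌢⇒≺ (⌢-mediantʳ σ⌢τ)
    minimal : (proj₁ σ , proj₂ τ) ⊑[ σ ⊞ τ ] u ⊞ v ⊞ l
    minimal = subst (_⊑[ σ ⊞ τ ] u ⊞ v ⊞ l) (corner-sum (proj₁ σ) (proj₂ τ))
      (⊑-⊞ (⊑-⊞ (corner-minimalₓ σ≺s (≺⇒0<p s≺τ) u∈) (corner-minimalᵧ s≺τ (≺⇒0<q σ≺s) v∈))
           (origin-⊑ (≺⇒0<q σ≺s) (≺⇒0<p s≺τ) l∈))

  -- Decomposing the points of Jℕ (σ ⊞ τ)

  dominate : ∀ k z → k ≤ ‖ z ‖ → ∃₂ λ u δ → ‖ u ‖ ≡ k × z ≡ u ⊞ δ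
  dominate zero    z              _         = (0 , 0) , z , refl , refl
  dominate (suc k) (suc m , n)    (s≤s k≤)  with dominate k (m , n) k≤
  ... | (a , b) , δ , refl , eq = (suc a , b) , δ , refl , cong (λ w → suc (proj₁ w) , proj₂ w) eq
  dominate (suc k) (zero , suc n) (s≤s k≤)  with dominate k (0 , n) k≤
  ... | (a , b) , δ , refl , eq = (a , suc b) , δ , +-suc a b , cong (λ w → proj₁ w , suc (proj₂ w)) eq

  upper-of-norm : ‖ s ‖ ≤ suc ‖ z ‖ → Upper s z
  upper-of-norm {q , p} {m , n} s≤ with q ≤? m
  ... | yes q≤m = begin
    q * p         ≤⟨ *-monoˡ-≤ p q≤m ⟩
    m * p         ≡⟨ *-comm m p ⟩
    p * m         ≤⟨ m≤m+n (p * m) (q * n) ⟩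
    p * m + q * n ∎
    where open ≤-Reasoning
  ... | no q≰m = begin
    q * p         ≤⟨ *-monoʳ-≤ q p≤n ⟩
    q * n         ≤⟨ m≤n+m (q * n) (p * m) ⟩
    p * m + q * n ∎
    where
    open ≤-Reasoning
    p≤n : p ≤ n
    p≤n = +-cancelˡ-≤ q p n (≤-trans s≤ (+-monoˡ-≤ n (≰⇒> q≰m)))

  Jℕ-below : 0 < ‖ σ ‖ → Upper σ z → ‖ z ‖ < ‖ σ ‖ + e →
             ∃₂ λ u δ → Jℕ σ u × z ≡ u ⊞ δ × ‖ δ ‖ ≤ e
  Jℕ-below {σ} {z} {e} 0<σ upper z< with ‖ z ‖ <? ‖ σ ‖
  ... | yes z<σ = z , (0 , 0) , (z<σ , upper) , sym (⊞-identityʳ z) , z≤n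
  ... | no z≮σ with dominate (pred ‖ σ ‖) z (≤-trans pred[n]≤n (≮⇒≥ z≮σ))
  ...   | u , δ , ‖u‖≡ , z≡ =
    u , δ , (≤-reflexive su≡σ , upper-of-norm {σ} {u} (≤-reflexive (sym su≡σ))) , z≡ , δ≤e
    where
    instance _ = >-nonZero 0<σ
    su≡σ : suc ‖ u ‖ ≡ ‖ σ ‖
    su≡σ = trans (cong suc ‖u‖≡) (suc-pred ‖ σ ‖)
    δ≤e : ‖ δ ‖ ≤ e
    δ≤e = +-cancelˡ-≤ ‖ u ‖ ‖ δ ‖ e
            (≤-pred (subst₂ _<_ (trans (cong ‖_‖ z≡) (‖‖-⊞ u δ)) (cong (_+ e) (sym su≡σ)) z<))

  Jℕ-near-cornerₓ : ∀ {i j} → i + j < p → Jℕ (q , p) (q + i , j)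
  Jℕ-near-cornerₓ {p} {q} {i} {j} ij<p =
    subst (_< q + p) (sym (+-assoc q i j)) (+-monoʳ-< q ij<p) ,
    (begin
      q * p               ≡⟨ *-comm q p ⟩
      p * q               ≤⟨ *-monoʳ-≤ p (m≤m+n q i) ⟩
      p * (q + i)         ≤⟨ m≤m+n (p * (q + i)) (q * j) ⟩
      p * (q + i) + q * j ∎)
    where open ≤-Reasoning

  near-cornerₓ : 0 < q → ‖ δ ‖ ≤ p → ∃₂ λ v l → Jℕ (q , p) v × Λℕ l × (q , 0) ⊞ δ ≡ v ⊞ l
  near-cornerₓ {q}     {suc i , j}    _ δ≤p =
    (q + i , j) , (1 , 0) , Jℕ-near-cornerₓ δ≤p , e₁ ,
    cong₂ _,_ (trans (+-suc q i) (+-comm 1 (q + i))) (sym (+-identityʳ j))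
  near-cornerₓ {q}     {zero , suc j} _ δ≤p =
    (q + 0 , j) , (0 , 1) , Jℕ-near-cornerₓ δ≤p , e₂ ,
    cong₂ _,_ (sym (+-identityʳ (q + 0))) (+-comm 1 j)
  near-cornerₓ {q}     {zero , zero} {suc p} _ _ = (q , 0) , (0 , 0) , Jℕ-cornerₓ (s≤s z≤n) , origin , refl
  near-cornerₓ {suc q} {zero , zero} {zero}  _ _ =
    (q , 0) , (1 , 0) , (≤-refl , ≤-refl) , e₁ , cong₂ _,_ (trans (cong suc (+-identityʳ q)) (+-comm 1 q)) refl

  near-cornerᵧ : 0 < p → ‖ δ ‖ ≤ q → ∃₂ λ u l → Jℕ (q , p) u × Λℕ l × (0 , p) ⊞ δ ≡ u ⊞ l
  near-cornerᵧ {p} {δ} {q} 0<p δ≤q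
    with near-cornerₓ {p} {swap δ} {q} 0<p (subst (_≤ q) (+-comm (proj₁ δ) (proj₂ δ)) δ≤q)
  ... | v , l , v∈ , l∈ , eq = swap v , swap l , Jℕ-swap v∈ , Λℕ-swap l∈ , cong swap eq

  k*m≤k*n+r⇒m≤n : ∀ k {m n r} → k * m ≤ k * n + r → r < k → m ≤ n
  k*m≤k*n+r⇒m≤n k {m} {n} {r} le r<k with m ≤? n
  ... | yes m≤n = m≤n
  ... | no m≰n  = ⊥-elim (<⇒≱ r<k (+-cancelˡ-≤ (k * n) k r (begin
    k * n + k ≡⟨ +-comm (k * n) k ⟩
    k + k * n ≡⟨ sym (*-suc k n) ⟩
    k * suc n ≤⟨ *-monoʳ-≤ k (≰⇒> m≰n) ⟩
    k * m     ≤⟨ le ⟩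
    k * n + r ∎)))
    where open ≤-Reasoning

  cover : σ ⌢ τ → Jℕ (σ ⊞ τ) (m , n) → proj₁ τ ≤ m ⊎ proj₂ σ ≤ n
  cover {a , b} {c , d} {m} {n} σ⌢τ (_ , upper) with c ≤? m | b ≤? n
  ... | yes c≤m | _       = inj₁ c≤m
  ... | no _    | yes b≤n = inj₂ b≤n
  ... | no c≰m  | no b≰n  = ⊥-elim (<⇒≱ below upper)
    where
    σ≺τ = ⌢⇒≺ σ⌢τ
    instance
      _ = >-nonZero (≤-trans (≺⇒0<p σ≺τ) (m≤m+n b d))
      _ = >-nonZero (≤-trans (≺⇒0<q σ≺τ) (m≤n+m c a))
    open ≤-Reasoning
    below : (b + d) * m + (a + c) * n < (a + c) * (b + d)
    below = ≤-pred (begin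
      suc (suc ((b + d) * m + (a + c) * n))  ≡⟨ cong suc (sym (+-suc ((b + d) * m) ((a + c) * n))) ⟩
      suc ((b + d) * m) + suc ((a + c) * n)
        ≤⟨ +-mono-≤ (*-monoʳ-< (b + d) (≰⇒> c≰m)) (*-monoʳ-< (a + c) (≰⇒> b≰n)) ⟩
      (b + d) * c + (a + c) * b              ≡⟨ ⌢-cover σ⌢τ ⟩
      1 + (a + c) * (b + d)                  ∎)

  upper-after-shift : σ ⌢ τ → Jℕ (σ ⊞ τ) (proj₁ τ + m , n) → Upper σ (m , n)
  upper-after-shift {a , b} {c , d} {m} {n} σ⌢τ (_ , upper) with n <? b + d
  ... | yes n<P = +-cancelˡ-≤ (b * c) (a * b) (b * m + a * n) (begin
    b * c + a * b              ≡⟨ solve (a ∷ b ∷ c ∷ []) ⟩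
    b * (a + c)                ≤⟨ k*m≤k*n+r⇒m≤n (b + d) scaled n<P ⟩
    b * (c + m) + a * n        ≡⟨ solve (a ∷ b ∷ c ∷ m ∷ n ∷ []) ⟩
    b * c + (b * m + a * n)    ∎)
    where
    open ≤-Reasoning
    scaled : (b + d) * (b * (a + c)) ≤ (b + d) * (b * (c + m) + a * n) + n
    scaled = begin
      (b + d) * (b * (a + c))                ≡⟨ solve (a ∷ b ∷ c ∷ d ∷ []) ⟩
      b * ((a + c) * (b + d))                ≤⟨ *-monoʳ-≤ b upper ⟩
      b * ((b + d) * (c + m) + (a + c) * n)  ≡⟨ sym (⌢-weight (⌢-mediantˡ σ⌢τ) (c + m , n)) ⟩
      (b + d) * (b * (c + m) + a * n) + n    ∎
  ... | no n≮P = begin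
    a * b          ≤⟨ *-monoʳ-≤ a (≤-trans (m≤m+n b d) (≮⇒≥ n≮P)) ⟩
    a * n          ≤⟨ m≤n+m (a * n) (b * m) ⟩
    b * m + a * n  ∎
    where open ≤-Reasoning

  decompose-right : σ ⌢ τ → Jℕ (σ ⊞ τ) (proj₁ τ + m , n) → Decomposition σ τ (proj₁ τ + m , n)
  decompose-right {a , b} {c , d} {m} {n} σ⌢τ j@(size , _) =
    let u , δ , u∈ , mn≡ , δ≤d = Jℕ-below {a , b} {m , n} {d} 0<‖σ‖ (upper-after-shift σ⌢τ j) size′
        v , l , v∈ , l∈ , c⊞δ≡ = near-cornerₓ {c} {δ} {d} (≺⇒0<q σ≺τ) δ≤d
    in  u , v , l , u∈ , v∈ , l∈ , ⊞-regroup {m , n} {u} {δ} {v} {l} {c , 0} mn≡ c⊞δ≡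
    where
    σ≺τ = ⌢⇒≺ σ⌢τ
    0<‖σ‖ : 0 < a + b
    0<‖σ‖ = ≤-trans (≺⇒0<p σ≺τ) (m≤n+m b a)
    size′ : m + n < a + b + d
    size′ = +-cancelˡ-< c (m + n) (a + b + d) (subst₂ _<_ (+-assoc c m n) regroup size)
      where
      regroup : (a + c) + (b + d) ≡ c + (a + b + d)
      regroup = solve (a ∷ b ∷ c ∷ d ∷ [])

  decompose-top : σ ⌢ τ → Jℕ (σ ⊞ τ) (m , proj₂ σ + n) → Decomposition σ τ (m , proj₂ σ + n)
  decompose-top {σ} {τ} {m} {n} σ⌢τ j =
    Decomposition-comm (Decomposition-swap (decompose-right (⌢-swap σ⌢τ)
      (subst (λ s → Jℕ s (proj₂ σ + n , m)) (⊞-comm (swap σ) (swap τ)) (Jℕ-swap j))))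

  decompose : σ ⌢ τ → Jℕ (σ ⊞ τ) z → Decomposition σ τ z
  decompose {z = m , n} σ⌢τ j with cover σ⌢τ j
  ... | inj₁ qτ≤m with m≤n⇒∃[o]m+o≡n qτ≤m
  ...   | _ , refl = decompose-right σ⌢τ j
  decompose {z = m , n} σ⌢τ j | inj₂ pσ≤n with m≤n⇒∃[o]m+o≡n pσ≤n
  ...   | _ , refl = decompose-top σ⌢τ j

  shift-⊆ : s₀ ⌢ s′ → Jℕ s′ z → Jℕ (s₀ ⊞ (s₀ ⊞ s′)) (s₀ ⊞ z) ⊎ z ≡ (0 , proj₂ s′)
  shift-⊆ {s₀} {s′} {z} s₀⌢s′ z∈@(z< , _) =
    [ (λ upper → inj₁ (size , upper)) , (λ eq → inj₂ (⊞-cancelˡ s₀ eq)) ]′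
      (⊑⇒Upper⊎≡ exception minimal)
    where
    S = s₀ ⊞ (s₀ ⊞ s′)
    S≺s′ : S ≺ s′
    S≺s′ = ⊞-≺ (⌢⇒≺ s₀⌢s′) (⌢⇒≺ (⌢-mediantʳ s₀⌢s′))
    minimal : s₀ ⊞ (0 , proj₂ s′) ⊑[ S ] s₀ ⊞ z
    minimal = ⊑-⊞ same
      (corner-minimalᵧ S≺s′ (≺⇒0<q (⌢⇒≺ (⌢-mediantˡ (⌢-mediantˡ s₀⌢s′)))) z∈)
    exception : 1 + weight S (s₀ ⊞ (0 , proj₂ s′)) ≡ area S
    exception = subst (λ x → 1 + weight S x ≡ area S) (cong (_, _) (sym (+-identityʳ (proj₁ s₀))))
                  (⌢-exception (⌢-mediantˡ s₀⌢s′))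
    size : ‖ s₀ ⊞ z ‖ < ‖ S ‖
    size = subst₂ _<_
      (sym (‖‖-⊞ s₀ z)) (sym (trans (‖‖-⊞ s₀ (s₀ ⊞ s′)) (cong (‖ s₀ ‖ +_) (‖‖-⊞ s₀ s′))))
      (+-monoʳ-< ‖ s₀ ‖ (<-≤-trans z< (m≤n+m ‖ s′ ‖ ‖ s₀ ‖)))

  -- Lemma 3.3 in halved coordinates, with exceptional point x₀ ∈ Jℕ s′; in this form the case of
  -- determinant −1 follows from the case +1 by exchanging coordinates (Splitting-swap).
  record Splitting (s₀ s′ x₀ : ℕ²) : Set where
    field
      shift   : Jℕ s′ z → Jℕ (s₀ ⊞ (s₀ ⊞ s′)) (s₀ ⊞ z) ⊎ z ≡ x₀
      x₀∈     : Jℕ s′ x₀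
      x₀∉     : ¬ Jℕ (s₀ ⊞ (s₀ ⊞ s′)) (s₀ ⊞ x₀)
      sum⊆    : Jℕ s₀ u → Jℕ (s₀ ⊞ s′) v → Λℕ l →
                Jℕ (s₀ ⊞ (s₀ ⊞ s′)) (u ⊞ v ⊞ l) ⊎ u ⊞ v ⊞ l ≡ s₀ ⊞ x₀
      ⊆sum    : Jℕ (s₀ ⊞ (s₀ ⊞ s′)) z → Decomposition s₀ (s₀ ⊞ s′) z
      x₀∈sum  : Decomposition s₀ (s₀ ⊞ s′) (s₀ ⊞ x₀)

  splitting : s₀ ⌢ s′ → Splitting s₀ s′ (0 , proj₂ s′)
  splitting {s₀} {s′} s₀⌢s′ = record
    { shift  = shift-⊆ s₀⌢s′
    ; x₀∈    = Jℕ-cornerᵧ (≺⇒0<q (⌢⇒≺ s₀⌢s′))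
    ; x₀∉    = exception∉ s₀⌢s₁ ∘ subst (Jℕ (s₀ ⊞ s₁)) corner
    ; sum⊆   = λ u∈ v∈ l∈ → map₂ (λ eq → trans eq (sym corner)) (⊕-⊆ s₀⌢s₁ u∈ v∈ l∈)
    ; ⊆sum   = decompose s₀⌢s₁
    ; x₀∈sum = subst (Decomposition s₀ s₁) (sym corner) (exception∈⊕ s₀⌢s₁)
    }
    where
    s₁ = s₀ ⊞ s′
    s₀⌢s₁ = ⌢-mediantˡ s₀⌢s′
    corner : s₀ ⊞ (0 , proj₂ s′) ≡ (proj₁ s₀ , proj₂ s₁)
    corner = cong (_, _) (+-identityʳ (proj₁ s₀))

  Splitting-swap : ∀ {x₀} → Splitting (swap s₀) (swap s′) (swap x₀) → Splitting s₀ s′ x₀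
  Splitting-swap S = record
    { shift  = λ z∈ → map Jℕ-swap (cong swap) (shift (Jℕ-swap z∈))
    ; x₀∈    = Jℕ-swap x₀∈
    ; x₀∉    = x₀∉ ∘ Jℕ-swap
    ; sum⊆   = λ u∈ v∈ l∈ →
        map Jℕ-swap (cong swap) (sum⊆ (Jℕ-swap u∈) (Jℕ-swap v∈) (Λℕ-swap l∈))
    ; ⊆sum   = Decomposition-swap ∘ ⊆sum ∘ Jℕ-swap
    ; x₀∈sum = Decomposition-swap x₀∈sum
    }
    where open Splitting S

open Halved

open import Data.Integer using (ℤ; +_; -_; _+_; _-_; _*_; _≤_; 0ℤ; 1ℤ; -1ℤ; -[1+_]; +≤+)
import Data.Integer.Properties as ℤ
import Data.Integer.Divisibility.Signed as Signed
open import Data.Integer.Divisibility using (_∣_)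
open import Data.Integer.Tactic.RingSolver using (solve-∀)
import Data.Nat as ℕ
import Data.Nat.Properties as ℕ
import Data.Product as Product

-- Back to ℤ²

i≡[i-j]+j : ∀ i j → i ≡ (i - j) + j
i≡[i-j]+j = solve-∀

unhalve₁ : ℕ → ℕ → ℤ
unhalve₁ q m = + 2 * + m - + q

unhalve : Slope → ℕ² → Pt
unhalve (q , p) (m , n) = unhalve₁ q m , unhalve₁ p n

unhalve₁-injective : ∀ q {m m′} → unhalve₁ q m ≡ unhalve₁ q m′ → m ≡ m′
unhalve₁-injective q {m} {m′} eq = ℤ.+-injective (ℤ.*-cancelˡ-≡ (+ 2) (+ m) (+ m′) (begin
  + 2 * + m             ≡⟨ i≡[i-j]+j (+ 2 * + m) (+ q) ⟩
  unhalve₁ q m + + q    ≡⟨ cong (_+ + q) eq ⟩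
  unhalve₁ q m′ + + q   ≡⟨ sym (i≡[i-j]+j (+ 2 * + m′) (+ q)) ⟩
  + 2 * + m′            ∎))
  where open ≡-Reasoning

unhalve-injective : ∀ s {z z′} → unhalve s z ≡ unhalve s z′ → z ≡ z′
unhalve-injective (q , p) eq =
  cong₂ _,_ (unhalve₁-injective q (cong proj₁ eq)) (unhalve₁-injective p (cong proj₂ eq))

unhalve₁-cast : ∀ {q m Q M} → + q ≡ Q → + m ≡ M → unhalve₁ q m ≡ + 2 * M - Q
unhalve₁-cast refl refl = refl

unhalve-shift : ∀ s₀ s′ z → unhalve s′ z ≡ unhalve (s₀ ⊞ (s₀ ⊞ s′)) (s₀ ⊞ z)
unhalve-shift (q₀ , p₀) (q′ , p′) (m , n) = cong₂ _,_ (shift₁ q₀ q′ m) (shift₁ p₀ p′ n)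
  where
  regroup : ∀ Q₀ Q′ M → + 2 * M - Q′ ≡ + 2 * (Q₀ + M) - (Q₀ + (Q₀ + Q′))
  regroup = solve-∀
  shift₁ : ∀ q₀ q′ m → unhalve₁ q′ m ≡ unhalve₁ (q₀ ℕ.+ (q₀ ℕ.+ q′)) (q₀ ℕ.+ m)
  shift₁ q₀ q′ m = trans (regroup (+ q₀) (+ q′) (+ m)) (sym (unhalve₁-cast
    (trans (ℤ.pos-+ q₀ (q₀ ℕ.+ q′)) (cong (_+_ (+ q₀)) (ℤ.pos-+ q₀ q′))) (ℤ.pos-+ q₀ m)))

unhalve-sum : ∀ σ τ u v l →
              (unhalve σ u +ᵥ unhalve τ v) +ᵥ unhalve (0 , 0) l ≡ unhalve (σ ⊞ τ) (u ⊞ v ⊞ l)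
unhalve-sum (q₀ , p₀) (q₁ , p₁) (u₁ , u₂) (v₁ , v₂) (l₁ , l₂) =
  cong₂ _,_ (sum₁ q₀ q₁ u₁ v₁ l₁) (sum₁ p₀ p₁ u₂ v₂ l₂)
  where
  regroup : ∀ Q₀ Q₁ U V L →
            (+ 2 * U - Q₀) + (+ 2 * V - Q₁) + (+ 2 * L - + 0) ≡ + 2 * (U + V + L) - (Q₀ + Q₁)
  regroup = solve-∀
  sum₁ : ∀ q₀ q₁ u v l →
         unhalve₁ q₀ u + unhalve₁ q₁ v + unhalve₁ 0 l ≡ unhalve₁ (q₀ ℕ.+ q₁) (u ℕ.+ v ℕ.+ l)
  sum₁ q₀ q₁ u v l = trans (regroup (+ q₀) (+ q₁) (+ u) (+ v) (+ l)) (sym (unhalve₁-cast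
    (ℤ.pos-+ q₀ q₁) (trans (ℤ.pos-+ (u ℕ.+ v) l) (cong (_+ + l) (ℤ.pos-+ u v)))))

nonNegative-half : ∀ t → 0ℤ ≤ + 2 * t → ∃[ m ] t ≡ + m
nonNegative-half (+ m)    _  = m , refl
nonNegative-half -[1+ _ ] ()

halve : ∀ q {α} → + 2 ∣ α - + q → - (+ q) ≤ α → ∃[ m ] α ≡ unhalve₁ q m
halve q {α} 2∣α-q -q≤α with Signed.∣ᵤ⇒∣ {+ 2} {α - + q} 2∣α-q
... | Signed.divides k α-q≡ =
  Product.map₂ (λ k+q≡m → trans α≡ (cong (λ t → + 2 * t - + q) k+q≡m))
               (nonNegative-half (k + + q) 0≤2[k+q])
  where
  open ≡-Reasoning
  regroup : ∀ K Q → K * + 2 + Q ≡ + 2 * (K + Q) - Q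
  regroup = solve-∀
  cancel : ∀ K Q → (+ 2 * (K + Q) - Q) - - Q ≡ + 2 * (K + Q)
  cancel = solve-∀
  α≡ : α ≡ + 2 * (k + + q) - + q
  α≡ = begin
    α                     ≡⟨ i≡[i-j]+j α (+ q) ⟩
    (α - + q) + + q       ≡⟨ cong (_+ + q) α-q≡ ⟩
    k * + 2 + + q         ≡⟨ regroup k (+ q) ⟩
    + 2 * (k + + q) - + q ∎
  0≤2[k+q] : 0ℤ ≤ + 2 * (k + + q)
  0≤2[k+q] = subst (0ℤ ≤_) (trans (cong (_- - (+ q)) α≡) (cancel k (+ q))) (ℤ.i≤j⇒0≤j-i -q≤α)

≤⇔≤ : ∀ {i j A B} → j - i ≡ + 2 * (+ B - + A) → i ≤ j ⇔ A ℕ.≤ B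
≤⇔≤ {i} {j} {A} {B} eq = mk⇔
  (λ i≤j → ℤ.drop‿+≤+ (ℤ.0≤i-j⇒j≤i
     (ℤ.*-cancelˡ-≤-pos 0ℤ (+ B - + A) (+ 2) (subst (0ℤ ≤_) eq (ℤ.i≤j⇒0≤j-i i≤j)))))
  (λ A≤B → ℤ.0≤i-j⇒j≤i (subst (0ℤ ≤_) (sym eq)
     (ℤ.*-monoˡ-≤-nonNeg (+ 2) (ℤ.i≤j⇒0≤j-i (+≤+ A≤B)))))

size⇔ : ∀ q p m n → unhalve₁ q m + unhalve₁ p n ≤ (+ p + + q) - + 2 ⇔ ℕ.suc (m ℕ.+ n) ℕ.≤ q ℕ.+ p
size⇔ q p m n = ≤⇔≤ (trans (regroup (+ m) (+ n) (+ q) (+ p)) (sym (cong₂ (λ B A → + 2 * (B - A))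
  (ℤ.pos-+ q p) (trans (ℤ.pos-+ 1 (m ℕ.+ n)) (cong (_+_ 1ℤ) (ℤ.pos-+ m n))))))
  where
  regroup : ∀ M N Q P → ((P + Q) - + 2) - ((+ 2 * M - Q) + (+ 2 * N - P)) ≡ + 2 * ((Q + P) - (1ℤ + (M + N)))
  regroup = solve-∀

upper⇔ : ∀ q p m n →
         0ℤ ≤ + p * unhalve₁ q m + + q * unhalve₁ p n ⇔ q ℕ.* p ℕ.≤ p ℕ.* m ℕ.+ q ℕ.* n
upper⇔ q p m n = ≤⇔≤ (trans (regroup (+ m) (+ n) (+ q) (+ p)) (sym (cong₂ (λ B A → + 2 * (B - A))
  (trans (ℤ.pos-+ (p ℕ.* m) (q ℕ.* n)) (cong₂ _+_ (ℤ.pos-* p m) (ℤ.pos-* q n))) (ℤ.pos-* q p))))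
  where
  regroup : ∀ M N Q P → (P * (+ 2 * M - Q) + Q * (+ 2 * N - P)) - 0ℤ ≡ + 2 * ((P * M + Q * N) - Q * P)
  regroup = solve-∀

unhalve₁-even : ∀ q m → + 2 ∣ unhalve₁ q m - + q
unhalve₁-even q m = Signed.∣⇒∣ᵤ (Signed.divides (+ m - + q) (regroup (+ m) (+ q)))
  where
  regroup : ∀ M Q → (+ 2 * M - Q) - Q ≡ (M - Q) * + 2
  regroup = solve-∀

unhalve₁-lower : ∀ q m → - (+ q) ≤ unhalve₁ q m
unhalve₁-lower q m = Equivalence.from (≤⇔≤ {A = 0} {B = m} (regroup (+ m) (+ q))) ℕ.z≤n
  where
  regroup : ∀ M Q → (+ 2 * M - Q) - - Q ≡ + 2 * (M - + 0)
  regroup = solve-∀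

Jℕ⇒J : ∀ {s z} → Jℕ s z → J s (unhalve s z)
Jℕ⇒J {q , p} {m , n} (size , upper) =
  unhalve₁-even q m , unhalve₁-even p n , unhalve₁-lower q m , unhalve₁-lower p n ,
  Equivalence.from (size⇔ q p m n) size , Equivalence.from (upper⇔ q p m n) upper

J⇒Jℕ : ∀ {s y} → J s y → ∃[ z ] (Jℕ s z × y ≡ unhalve s z)
J⇒Jℕ {q , p} (2∣α-q , 2∣β-p , -q≤α , -p≤β , size , upper)
  with halve q 2∣α-q -q≤α | halve p 2∣β-p -p≤β
... | m , refl | n , refl =
  (m , n) , (Equivalence.to (size⇔ q p m n) size , Equivalence.to (upper⇔ q p m n) upper) , refl

Λ⇒Λℕ : ∀ {y} → Λ y → ∃[ l ] (Λℕ l × y ≡ unhalve (0 , 0) l)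
Λ⇒Λℕ (inj₁ refl)        = (0 , 0) , origin , refl
Λ⇒Λℕ (inj₂ (inj₁ refl)) = (0 , 1) , e₂ , refl
Λ⇒Λℕ (inj₂ (inj₂ refl)) = (1 , 0) , e₁ , refl

Λℕ⇒Λ : ∀ {l} → Λℕ l → Λ (unhalve (0 , 0) l)
Λℕ⇒Λ origin = inj₁ refl
Λℕ⇒Λ e₂     = inj₂ (inj₁ refl)
Λℕ⇒Λ e₁     = inj₂ (inj₂ refl)

Decomposition⇒⊕ : ∀ {σ τ z} → Decomposition σ τ z → ((J σ ⊕ J τ) ⊕ Λ) (unhalve (σ ⊞ τ) z)
Decomposition⇒⊕ {σ} {τ} (u , v , l , u∈ , v∈ , l∈ , refl) =
  _ , _ , (_ , _ , Jℕ⇒J u∈ , Jℕ⇒J v∈ , refl) , Λℕ⇒Λ l∈ , sym (unhalve-sum σ τ u v l)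

module Assembly {s₀ s′ x₀ : ℕ²} (S : Splitting s₀ s′ x₀) where
  open Splitting S

  private
    s₁ s : Slope
    s₁ = s₀ ⊞ s′
    s  = s₀ ⊞ s₁

    x : Pt
    x = unhalve s′ x₀

    x≡ : x ≡ unhalve s (s₀ ⊞ x₀)
    x≡ = unhalve-shift s₀ s′ x₀

  x∉J : ¬ J s x
  x∉J j with J⇒Jℕ j
  ... | z , z∈ , x≡unhalve = x₀∉ (subst (Jℕ s) (sym (unhalve-injective s (trans (sym x≡) x≡unhalve))) z∈)

  difference : ∀ y → (J s′ y × ¬ J s y) ⇔ (y ≡ x)
  difference y = mk⇔ to from
    where
    to : ∀ {y} → J s′ y × ¬ J s y → y ≡ x
    to (j , ¬j) with J⇒Jℕ j
    ... | z , z∈ , refl with shift z∈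
    ...   | inj₁ s₀⊞z∈ = ⊥-elim (¬j (subst (J s) (sym (unhalve-shift s₀ s′ z)) (Jℕ⇒J s₀⊞z∈)))
    ...   | inj₂ refl  = refl
    from : ∀ {y} → y ≡ x → J s′ y × ¬ J s y
    from refl = Jℕ⇒J x₀∈ , x∉J

  minkowski : ∀ y → ((J s₀ ⊕ J s₁) ⊕ Λ) y ⇔ (J s y ⊎ y ≡ x)
  minkowski y = mk⇔ to from
    where
    to : ∀ {y} → ((J s₀ ⊕ J s₁) ⊕ Λ) y → J s y ⊎ y ≡ x
    to (_ , w , (a , b , a∈ , b∈ , refl) , w∈ , refl) with J⇒Jℕ a∈ | J⇒Jℕ b∈ | Λ⇒Λℕ w∈
    ... | u , u∈ , refl | v , v∈ , refl | l , l∈ , refl with sum⊆ u∈ v∈ l∈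
    ...   | inj₁ sum∈ = inj₁ (subst (J s) (sym (unhalve-sum s₀ s₁ u v l)) (Jℕ⇒J sum∈))
    ...   | inj₂ eq   = inj₂ (trans (unhalve-sum s₀ s₁ u v l) (trans (cong (unhalve s) eq) (sym x≡)))
    from : ∀ {y} → J s y ⊎ y ≡ x → ((J s₀ ⊕ J s₁) ⊕ Λ) y
    from (inj₁ j) with J⇒Jℕ j
    ... | z , z∈ , refl = Decomposition⇒⊕ (⊆sum z∈)
    from (inj₂ refl) = subst ((J s₀ ⊕ J s₁) ⊕ Λ) (sym x≡) (Decomposition⇒⊕ x₀∈sum)

  conclusion : ExtremalPoint s′ x →
    ∃[ x ] ((∀ y → (J s′ y × ¬ J s y) ⇔ (y ≡ x)) × ExtremalPoint s′ x × ¬ J s x ×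
            (∀ y → ((J s₀ ⊕ J s₁) ⊕ Λ) y ⇔ (J s y ⊎ y ≡ x)))
  conclusion extremal = x , difference , extremal , x∉J , minkowski

extremal-top : ∀ {q₀ p₀ q′ p′} → (q₀ , p₀) ⌢ (q′ , p′) →
               ExtremalPoint (q′ , p′) (unhalve (q′ , p′) (0 , p′))
extremal-top {q₀} {p₀} {q′} {ℕ.zero} (⌢-intro det) with ℕ.m*n≡1⇒n≡1 p₀ q′ det
... | refl = inj₂ (inj₁ (refl , refl , refl))
extremal-top {q₀} {p₀} {q′} {ℕ.suc k} s₀⌢s′ =
  inj₂ (inj₂ (ℕ.m<n⇒n≢0 (≺⇒0<q (⌢⇒≺ s₀⌢s′)) , (λ ()) ,
              inj₂ (inj₂ (inj₁ (cong₂ _,_ (α≡ (+ q′)) (β≡ (+ ℕ.suc k)))))))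
  where
  α≡ : ∀ Q → + 2 * + 0 - Q ≡ - Q
  α≡ = solve-∀
  β≡ : ∀ P → + 2 * P - P ≡ P + + 2 * + 0
  β≡ = solve-∀

extremal-right : ∀ {q₀ p₀ q′ p′} → (q′ , p′) ⌢ (q₀ , p₀) →
                 ExtremalPoint (q′ , p′) (unhalve (q′ , p′) (q′ , 0))
extremal-right {q₀} {p₀} {ℕ.zero} {p′} (⌢-intro det)
  with ℕ.m*n≡1⇒m≡1 p′ q₀ (trans det (cong ℕ.suc (ℕ.*-zeroʳ p₀)))
... | refl = inj₁ (refl , refl , refl)
extremal-right {q₀} {p₀} {ℕ.suc k} {p′} s′⌢s₀ =
  inj₂ (inj₂ ((λ ()) , ℕ.m<n⇒n≢0 (≺⇒0<p (⌢⇒≺ s′⌢s₀)) ,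
              inj₁ (cong₂ _,_ (α≡ (+ ℕ.suc k)) (β≡ (+ p′)))))
  where
  α≡ : ∀ Q → + 2 * Q - Q ≡ Q + + 2 * + 0
  α≡ = solve-∀
  β≡ : ∀ P → + 2 * + 0 - P ≡ - P
  β≡ = solve-∀

det⇒⌢ : ∀ {q₀ p₀ q₁ p₁} → + p₀ * + q₁ - + p₁ * + q₀ ≡ 1ℤ → (q₀ , p₀) ⌢ (q₁ , p₁)
det⇒⌢ {q₀} {p₀} {q₁} {p₁} det = ⌢-intro (ℤ.+-injective (begin
  + (p₀ ℕ.* q₁)                               ≡⟨ ℤ.pos-* p₀ q₁ ⟩
  + p₀ * + q₁                                 ≡⟨ i≡[i-j]+j (+ p₀ * + q₁) (+ p₁ * + q₀) ⟩
  (+ p₀ * + q₁ - + p₁ * + q₀) + + p₁ * + q₀   ≡⟨ cong (_+ + p₁ * + q₀) det ⟩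
  1ℤ + + p₁ * + q₀                            ≡⟨ cong (_+_ 1ℤ) (sym (ℤ.pos-* p₁ q₀)) ⟩
  + (1 ℕ.+ p₁ ℕ.* q₀)                         ∎))
  where open ≡-Reasoning

det⇒⌢⁻ : ∀ {q₀ p₀ q₁ p₁} → + p₀ * + q₁ - + p₁ * + q₀ ≡ -1ℤ → (q₁ , p₁) ⌢ (q₀ , p₀)
det⇒⌢⁻ {q₀} {p₀} {q₁} {p₁} det = det⇒⌢ (trans (flip (+ p₀ * + q₁) (+ p₁ * + q₀)) (cong -_ det))
  where
  flip : ∀ A B → B - A ≡ - (A - B)
  flip = solve-∀

lemma3p3 : (s s₀ s₁ s′ : Slope) →
    Coprime (proj₁ s) (proj₂ s) →
    s ≢ (0 , 1) → s ≢ (1 , 1) → s ≢ (1 , 0) →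
    Parents s s₀ s₁ →
    Parents s₁ s₀ s′ →
    ∃[ x ] ((∀ y → (J s′ y × ¬ J s y) ⇔ (y ≡ x)) ×
            ExtremalPoint s′ x ×
            ¬ J s x ×
            (∀ y → ((J s₀ ⊕ J s₁) ⊕ Λ) y ⇔ (J s y ⊎ y ≡ x)))
-- Coprimality and s ∉ {0, 1, ∞} follow from the determinant condition of Parents.
lemma3p3 (q , p) s₀ (q₁ , p₁) s′ _ _ _ _ (refl , refl , _) (refl , refl , inj₁ det) =
  Assembly.conclusion (splitting s₀⌢s′) (extremal-top s₀⌢s′)
  where s₀⌢s′ = det⇒⌢ det
lemma3p3 (q , p) s₀ (q₁ , p₁) s′ _ _ _ _ (refl , refl , _) (refl , refl , inj₂ det) =
  Assembly.conclusion (Splitting-swap (splitting (⌢-swap s′⌢s₀))) (extremal-right s′⌢s₀)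
  where s′⌢s₀ = det⇒⌢⁻ det
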